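{- (a) For all integers $d\ge1$ and $n\ge1$ there exists a $d$-regular bipartite graph (multiple edges allowed) on $2n$ vertices with an edge $e$ such that \[p(e)=\frac{1}{(d-1)^n+1}.\] (b) For all integers $d\ge1$ and $n\ge1$ there exists a $d$-regular bipartite simple graph on $2dn$ vertices with an edge $e$ such that $p(e)=\frac{1}{(d-1)^n+1}$.
   Context: For a finite graph admitting a perfect matching and an edge $e$ of it, $p(e)$ is the probability that $e$ is contained in a uniformly random perfect matching of the graph (with parallel edges regarded as distinct). -}

module Defs where

open import Data.Nat using (ℕ; zero; suc; _+_)
open import Data.Bool using (Bool; true; false; _∧_)
open import Data.Fin using (Fin; zero; suc; _≟_)
open import Data.Fin.Properties using (all?)
open import Data.Vec using (Vec; []; _∷_; lookup)
open import Data.List using (List; []; _∷_; _++_; map; filter; length)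
open import Data.Product using (_×_; _,_)
open import Data.Product.Properties using ()
open import Relation.Nullary.Decidable using (⌊_⌋; _×-dec_)
open import Relation.Binary.PropositionalEquality using (_≡_)
import Data.Nat.Properties as ℕP

countTrue : (m : ℕ) → (Fin m → Bool) → ℕ
countTrue zero    f = 0
countTrue (suc m) f with f zero
... | true  = suc (countTrue m (λ i → f (suc i)))
... | false = countTrue m (λ i → f (suc i))

-- A finite bipartite multigraph with colour classes Fin a and Fin b and
-- m edges labelled by Fin m (parallel edges are distinct labels).
record BipGraph (a b m : ℕ) : Set where
  field
    left  : Fin m → Fin a
    right : Fin m → Fin b
open BipGraph public

module _ {a b m : ℕ} (G : BipGraph a b m) where

  degL : Fin a → ℕ
  degL u = countTrue m (λ i → ⌊ left G i ≟ u ⌋)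

  degR : Fin b → ℕ
  degR v = countTrue m (λ i → ⌊ right G i ≟ v ⌋)

  Regular : ℕ → Set
  Regular d = (∀ u → degL u ≡ d) × (∀ v → degR v ≡ d)

  Simple : Set
  Simple = ∀ i j → left G i ≡ left G j → right G i ≡ right G j → i ≡ j

  IsPerfectMatching : Vec Bool m → Set
  IsPerfectMatching S =
    (∀ u → countTrue m (λ i → lookup S i ∧ ⌊ left G i ≟ u ⌋) ≡ 1) ×
    (∀ v → countTrue m (λ i → lookup S i ∧ ⌊ right G i ≟ v ⌋) ≡ 1)

  isPerfectMatching? : (S : Vec Bool m) → Relation.Nullary.Decidable.Dec (IsPerfectMatching S)
  isPerfectMatching? S =
    all? (λ u → countTrue m (λ i → lookup S i ∧ ⌊ left G i ≟ u ⌋) ℕP.≟ 1) ×-dec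
    all? (λ v → countTrue m (λ i → lookup S i ∧ ⌊ right G i ≟ v ⌋) ℕP.≟ 1)

allSubsets : (m : ℕ) → List (Vec Bool m)
allSubsets zero    = [] ∷ []
allSubsets (suc m) = map (true ∷_) (allSubsets m) ++ map (false ∷_) (allSubsets m)

module _ {a b m : ℕ} (G : BipGraph a b m) where

  numPM : ℕ
  numPM = length (filter (isPerfectMatching? G) (allSubsets m))

  numPMwith : Fin m → ℕ
  numPMwith e = length (filter (λ S → isPerfectMatching? G S ×-dec (lookup S e Data.Bool.≟ true)) (allSubsets m))

-- p(e) = 1 / k  (the graph has a perfect matching and
--   #{PM containing e} / #{PM} = 1 / k), written without division
ProbEq1/ : {a b m : ℕ} → BipGraph a b m → Fin m → ℕ → Set
ProbEq1/ G e k = (0 Data.Nat.< numPM G) × (numPMwith G e * k ≡ numPM G)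
  where open Data.Nat using (_*_)

-- Both graphs are necklaces: n copies of a bipartite gadget placed on a cycle, each gadget
-- sending a single edge to the next one. Counting the edges at the vertices of one gadget
-- shows that a perfect matching uses as many edges leaving a gadget as entering it, so it
-- uses either all n connecting edges or none of them. With c₁ and c₀ the numbers of ways to
-- cover one gadget with and without its connecting edges, there are c₁ⁿ + c₀ⁿ perfect
-- matchings, c₁ⁿ of which contain a given connecting edge. For (a) the gadget is one left and
-- one right vertex joined by d − 1 parallel edges, so c₁ = 1 and c₀ = d − 1; for (b) it is
-- K_{d,d} with one edge redirected to the next gadget, whose coverings are the permutation
-- matrices, so c₁ = (d − 1)! and c₀ = (d − 1)·(d − 1)!. In both cases c₀ = (d − 1)·c₁, which
-- gives p(e) = c₁ⁿ / (c₁ⁿ + c₀ⁿ) = 1 / ((d − 1)ⁿ + 1).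
module Submission where

open import Defs
open import Data.Bool using (Bool; true; false; _∧_)
import Data.Bool as Bool
open import Data.Empty using (⊥-elim)
open import Data.Fin using (Fin; zero; suc; _↑ˡ_; _↑ʳ_; combine; remQuot; fromℕ; inject₁; _≟_)
open import Data.Fin.Properties using (all?; combine-injective; remQuot-combine; combine-remQuot)
open import Data.Fin.Relation.Unary.Top using (View; view; ‵fromℕ; ‵inj₁; view-fromℕ; view-inject₁)
open import Data.List using (List; []; _∷_; filter; length)
import Data.List as List
open import Data.List.Properties using (filter-++; length-++)
open import Data.Maybe using (Maybe; just; nothing)
open import Data.Maybe.Properties using (just-injective)
open import Data.Nat using (ℕ; zero; suc; _+_; _*_; _∸_; _^_; _!; _≤_; _<_; _≥_; z≤n; s≤s; _≤?_; >-nonZero)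
open import Data.Nat.Properties hiding (_≟_)
import Data.Nat.Properties as ℕ
open import Data.Product using (Σ; _×_; _,_; proj₁; proj₂; ∃-syntax)
open import Data.Sum using (_⊎_; inj₁; inj₂; [_,_])
open import Data.Vec using (Vec; []; _∷_; lookup; replicate; _++_)
open import Data.Vec.Properties using (lookup-++ˡ; lookup-++ʳ; lookup-replicate)
open import Function using (_∘_)
open import Relation.Nullary using (Dec; yes; no; ¬_; does)
open import Relation.Nullary.Decidable using (⌊_⌋; _×-dec_; map′; isYes≗does)
open import Relation.Binary.PropositionalEquality
  using (_≡_; _≢_; refl; sym; trans; cong; cong₂; subst; subst₂; module ≡-Reasoning)
open import Algebra.Properties.Semiring.Sum +-*-semiring
  using (sum; sum-syntax; sum-cong-≗; sum-replicate-zero; ∑-distrib-+; ∑-comm; *-distribˡ-sum; *-distribʳ-sum)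
open import Data.Nat.Tactic.RingSolver using (solve-∀)

-- Indicators and finite sums

𝟙 : Bool → ℕ
𝟙 true  = 1
𝟙 false = 0

χ : {P : Set} → Dec P → ℕ
χ P? = 𝟙 (does P?)

δ : ∀ {n} → Fin n → Fin n → ℕ
δ i j = χ (i ≟ j)

𝟙-∧ : ∀ a b → 𝟙 (a ∧ b) ≡ 𝟙 a * 𝟙 b
𝟙-∧ true  b = sym (+-identityʳ (𝟙 b))
𝟙-∧ false b = refl

𝟙≡1⇒≡true : ∀ {b} → 𝟙 b ≡ 1 → b ≡ true
𝟙≡1⇒≡true {true} _ = refl

χ-yes : ∀ {P : Set} (P? : Dec P) → P → χ P? ≡ 1
χ-yes (yes _) _ = refl
χ-yes (no ¬p) p = ⊥-elim (¬p p)

χ-no : ∀ {P : Set} (P? : Dec P) → ¬ P → χ P? ≡ 0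
χ-no (yes p) ¬p = ⊥-elim (¬p p)
χ-no (no _)  _  = refl

module _ {P Q : Set} where

  χ-cong : (P? : Dec P) (Q? : Dec Q) → (P → Q) → (Q → P) → χ P? ≡ χ Q?
  χ-cong (yes p) Q? to from = sym (χ-yes Q? (to p))
  χ-cong (no ¬p) Q? to from = sym (χ-no Q? (¬p ∘ from))

  χ-× : (P? : Dec P) (Q? : Dec Q) → χ (P? ×-dec Q?) ≡ χ P? * χ Q?
  χ-× P? Q? = 𝟙-∧ (does P?) (does Q?)

  χ-⊎ : ∀ {R : Set} (P? : Dec P) (Q? : Dec Q) (R? : Dec R) →
        (R → P ⊎ Q) → (P ⊎ Q → R) → (P → ¬ Q) → χ R? ≡ χ P? + χ Q?
  χ-⊎ (yes p) (yes q) R? _  _    disj = ⊥-elim (disj p q)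
  χ-⊎ (yes p) (no _)  R? _  from _    = χ-yes R? (from (inj₁ p))
  χ-⊎ (no _)  (yes q) R? _  from _    = χ-yes R? (from (inj₂ q))
  χ-⊎ (no ¬p) (no ¬q) R? to _    _    = χ-no R? ([ ¬p , ¬q ] ∘ to)

module _ {n : ℕ} where

  δ-refl : (i : Fin n) → δ i i ≡ 1
  δ-refl i = χ-yes (i ≟ i) refl

  δ-≢ : {i j : Fin n} → i ≢ j → δ i j ≡ 0
  δ-≢ {i} {j} = χ-no (i ≟ j)

  δ-sym : (i j : Fin n) → δ i j ≡ δ j i
  δ-sym i j = χ-cong (i ≟ j) (j ≟ i) sym sym

δ-combine : ∀ {m n} (i j : Fin m) (a b : Fin n) → δ (combine i a) (combine j b) ≡ δ i j * δ a b
δ-combine i j a b =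
  trans (χ-cong (combine i a ≟ combine j b) ((i ≟ j) ×-dec (a ≟ b))
                (combine-injective i a j b) (λ (i≡j , a≡b) → cong₂ combine i≡j a≡b))
        (χ-× (i ≟ j) (a ≟ b))

∑-const : ∀ n c → ∑[ i < n ] c ≡ n * c
∑-const zero    c = refl
∑-const (suc n) c = cong (c +_) (∑-const n c)

∑-splitAt : ∀ m n (f : Fin (m + n) → ℕ) → sum f ≡ ∑[ i < m ] f (i ↑ˡ n) + ∑[ j < n ] f (m ↑ʳ j)
∑-splitAt zero    n f = refl
∑-splitAt (suc m) n f = trans (cong (f zero +_) (∑-splitAt m n (f ∘ suc))) (sym (+-assoc (f zero) _ _))

∑-combine : ∀ m n (f : Fin (m * n) → ℕ) → sum f ≡ ∑[ i < m ] ∑[ j < n ] f (combine i j)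
∑-combine zero    n f = refl
∑-combine (suc m) n f = trans (∑-splitAt n (m * n) f) (cong (sum (f ∘ (_↑ˡ (m * n))) +_) (∑-combine m n (f ∘ (n ↑ʳ_))))

∑-δ : ∀ {n} (j : Fin n) (f : Fin n → ℕ) → ∑[ i < n ] (δ i j * f i) ≡ f j
∑-δ {suc n} zero    f = trans (cong₂ _+_ (*-identityˡ (f zero)) (sum-replicate-zero n)) (+-identityʳ _)
∑-δ {suc n} (suc j) f = ∑-δ j (f ∘ suc)

∑-δ₁ : ∀ {n} (j : Fin n) → ∑[ i < n ] δ j i ≡ 1
∑-δ₁ j = trans (sum-cong-≗ (λ i → trans (δ-sym j i) (sym (*-identityʳ (δ i j))))) (∑-δ j (λ _ → 1))

∑∑-factorˡ : ∀ {m n} (a : Fin m → ℕ) (g : Fin m → Fin n → ℕ) →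
             ∑[ j < n ] ∑[ i < m ] (a i * g i j) ≡ ∑[ i < m ] (a i * ∑[ j < n ] g i j)
∑∑-factorˡ a g = trans (∑-comm (λ j i → a i * g i j)) (sum-cong-≗ (λ i → sym (*-distribˡ-sum (a i) (g i))))

∑≡0⇒≡0 : ∀ {n} (f : Fin n → ℕ) → sum f ≡ 0 → ∀ i → f i ≡ 0
∑≡0⇒≡0 f ∑f≡0 zero    = m+n≡0⇒m≡0 (f zero) ∑f≡0
∑≡0⇒≡0 f ∑f≡0 (suc i) = ∑≡0⇒≡0 (f ∘ suc) (m+n≡0⇒n≡0 (f zero) ∑f≡0) i

countTrue≡∑ : ∀ m (f : Fin m → Bool) → countTrue m f ≡ ∑[ i < m ] 𝟙 (f i)
countTrue≡∑ zero    f = refl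
countTrue≡∑ (suc m) f with f zero
... | true  = cong suc (countTrue≡∑ m (f ∘ suc))
... | false = countTrue≡∑ m (f ∘ suc)

degree≡∑ : ∀ {m a} (σ : Fin m → Bool) (end : Fin m → Fin a) (v : Fin a) →
           countTrue m (λ i → σ i ∧ ⌊ end i ≟ v ⌋) ≡ ∑[ i < m ] (𝟙 (σ i) * δ (end i) v)
degree≡∑ {m} σ end v = trans (countTrue≡∑ m _)
  (sum-cong-≗ (λ i → trans (𝟙-∧ (σ i) _) (cong (λ b → 𝟙 (σ i) * 𝟙 b) (isYes≗does (end i ≟ v)))))

-- Sums over Boolean vectors

∑ᵇ : ∀ m → (Vec Bool m → ℕ) → ℕ
∑ᵇ zero    f = f []
∑ᵇ (suc m) f = ∑ᵇ m (λ x → f (true ∷ x)) + ∑ᵇ m (λ x → f (false ∷ x))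

length-filter-map : ∀ {A B : Set} {P : B → Set} (P? : ∀ y → Dec (P y)) (f : A → B) (xs : List A) →
                    length (filter P? (List.map f xs)) ≡ length (filter (P? ∘ f) xs)
length-filter-map P? f []       = refl
length-filter-map P? f (x ∷ xs) with does (P? (f x))
... | true  = cong suc (length-filter-map P? f xs)
... | false = length-filter-map P? f xs

count≡∑ᵇ : ∀ m {P : Vec Bool m → Set} (P? : ∀ x → Dec (P x)) →
           length (filter P? (allSubsets m)) ≡ ∑ᵇ m (λ x → χ (P? x))
count≡∑ᵇ zero    P? with does (P? [])
... | true  = refl
... | false = refl
count≡∑ᵇ (suc m) P? = begin
  length (filter P? (List.map (true ∷_) xs List.++ List.map (false ∷_) xs))
    ≡⟨ cong length (filter-++ P? (List.map (true ∷_) xs) _) ⟩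
  length (filter P? (List.map (true ∷_) xs) List.++ filter P? (List.map (false ∷_) xs))
    ≡⟨ length-++ (filter P? (List.map (true ∷_) xs)) ⟩
  length (filter P? (List.map (true ∷_) xs)) + length (filter P? (List.map (false ∷_) xs))
    ≡⟨ cong₂ _+_ (length-filter-map P? (true ∷_) xs) (length-filter-map P? (false ∷_) xs) ⟩
  length (filter (P? ∘ (true ∷_)) xs) + length (filter (P? ∘ (false ∷_)) xs)
    ≡⟨ cong₂ _+_ (count≡∑ᵇ m (P? ∘ (true ∷_))) (count≡∑ᵇ m (P? ∘ (false ∷_))) ⟩
  ∑ᵇ (suc m) (λ x → χ (P? x)) ∎
  where
  open ≡-Reasoning
  xs = allSubsets m

∑ᵇ-cong : ∀ m {f g : Vec Bool m → ℕ} → (∀ x → f x ≡ g x) → ∑ᵇ m f ≡ ∑ᵇ m g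
∑ᵇ-cong zero    f≗g = f≗g []
∑ᵇ-cong (suc m) f≗g = cong₂ _+_ (∑ᵇ-cong m (f≗g ∘ (true ∷_))) (∑ᵇ-cong m (f≗g ∘ (false ∷_)))

∑ᵇ-zero : ∀ m {f : Vec Bool m → ℕ} → (∀ x → f x ≡ 0) → ∑ᵇ m f ≡ 0
∑ᵇ-zero zero    f≗0 = f≗0 []
∑ᵇ-zero (suc m) f≗0 = cong₂ _+_ (∑ᵇ-zero m (f≗0 ∘ (true ∷_))) (∑ᵇ-zero m (f≗0 ∘ (false ∷_)))

∑ᵇ-distrib-+ : ∀ m (f g : Vec Bool m → ℕ) → ∑ᵇ m (λ x → f x + g x) ≡ ∑ᵇ m f + ∑ᵇ m g
∑ᵇ-distrib-+ zero    f g = refl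
∑ᵇ-distrib-+ (suc m) f g =
  trans (cong₂ _+_ (∑ᵇ-distrib-+ m (f ∘ (true ∷_)) (g ∘ (true ∷_)))
                   (∑ᵇ-distrib-+ m (f ∘ (false ∷_)) (g ∘ (false ∷_))))
        (+-+-comm (∑ᵇ m (f ∘ (true ∷_))) _ _ _)
  where
  +-+-comm : ∀ a b c d → a + b + (c + d) ≡ a + c + (b + d)
  +-+-comm = solve-∀

*-distribˡ-∑ᵇ : ∀ m c (f : Vec Bool m → ℕ) → ∑ᵇ m (λ x → c * f x) ≡ c * ∑ᵇ m f
*-distribˡ-∑ᵇ zero    c f = refl
*-distribˡ-∑ᵇ (suc m) c f =
  trans (cong₂ _+_ (*-distribˡ-∑ᵇ m c (f ∘ (true ∷_))) (*-distribˡ-∑ᵇ m c (f ∘ (false ∷_))))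
        (sym (*-distribˡ-+ c _ _))

*-distribʳ-∑ᵇ : ∀ m c (f : Vec Bool m → ℕ) → ∑ᵇ m (λ x → f x * c) ≡ ∑ᵇ m f * c
*-distribʳ-∑ᵇ m c f =
  trans (∑ᵇ-cong m (λ x → *-comm (f x) c)) (trans (*-distribˡ-∑ᵇ m c f) (*-comm c _))

∑ᵇ-++ : ∀ a b (f : Vec Bool (a + b) → ℕ) → ∑ᵇ (a + b) f ≡ ∑ᵇ a (λ x → ∑ᵇ b (λ y → f (x ++ y)))
∑ᵇ-++ zero    b f = refl
∑ᵇ-++ (suc a) b f = cong₂ _+_ (∑ᵇ-++ a b (f ∘ (true ∷_))) (∑ᵇ-++ a b (f ∘ (false ∷_)))

weight : ∀ {m} → Vec Bool m → ℕ
weight {m} x = ∑[ i < m ] 𝟙 (lookup x i)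

unit : ∀ {m} → Fin m → Vec Bool m
unit {suc m} zero    = true ∷ replicate m false
unit         (suc j) = false ∷ unit j

𝟙-lookup-unit : ∀ {m} (j c : Fin m) → 𝟙 (lookup (unit j) c) ≡ δ c j
𝟙-lookup-unit         zero    zero    = refl
𝟙-lookup-unit {suc m} zero    (suc c) = cong 𝟙 (lookup-replicate c false)
𝟙-lookup-unit         (suc j) zero    = refl
𝟙-lookup-unit         (suc j) (suc c) = 𝟙-lookup-unit j c

∑-unit : ∀ {m} (j : Fin m) (w : Fin m → ℕ) → ∑[ c < m ] (𝟙 (lookup (unit j) c) * w c) ≡ w j
∑-unit j w = trans (sum-cong-≗ (λ c → cong (_* w c) (𝟙-lookup-unit j c))) (∑-δ j w)

∑ᵇ-weight0 : ∀ m (f : Vec Bool m → ℕ) → (∀ x → weight x ≢ 0 → f x ≡ 0) → ∑ᵇ m f ≡ f (replicate m false)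
∑ᵇ-weight0 zero    f _   = refl
∑ᵇ-weight0 (suc m) f hyp =
  trans (cong (_+ ∑ᵇ m (f ∘ (false ∷_))) (∑ᵇ-zero m (λ x → hyp (true ∷ x) (λ ()))))
        (∑ᵇ-weight0 m (f ∘ (false ∷_)) (hyp ∘ (false ∷_)))

∑ᵇ-weight1 : ∀ m (f : Vec Bool m → ℕ) → (∀ x → weight x ≢ 1 → f x ≡ 0) → ∑ᵇ m f ≡ ∑[ j < m ] f (unit j)
∑ᵇ-weight1 zero    f hyp = hyp [] (λ ())
∑ᵇ-weight1 (suc m) f hyp =
  cong₂ _+_ (∑ᵇ-weight0 m (f ∘ (true ∷_)) (λ x w≢0 → hyp (true ∷ x) (w≢0 ∘ suc-injective)))
            (∑ᵇ-weight1 m (f ∘ (false ∷_)) (hyp ∘ (false ∷_)))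

module _ {q : ℕ} {P : (Fin q → Bool) → Set} (P? : ∀ s → Dec (P s))
         (P-resp : ∀ {s t} → (∀ e → s e ≡ t e) → P s → P t) where

  blockwise : ∀ N → Vec Bool (N * q) → Set
  blockwise N S = ∀ i → P (λ e → lookup S (combine {N} i e))

  blockwise? : ∀ N S → Dec (blockwise N S)
  blockwise? N S = all? (λ i → P? (λ e → lookup S (combine {N} i e)))

  ∑ᵇ-blockwise : ∀ N → ∑ᵇ (N * q) (λ S → χ (blockwise? N S)) ≡ ∑ᵇ q (λ v → χ (P? (lookup v))) ^ N
  ∑ᵇ-blockwise zero    = χ-yes (blockwise? zero []) (λ ())
  ∑ᵇ-blockwise (suc N) = begin
    ∑ᵇ (q + N * q) (λ S → χ (blockwise? (suc N) S))
      ≡⟨ ∑ᵇ-++ q (N * q) _ ⟩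
    ∑ᵇ q (λ v → ∑ᵇ (N * q) (λ w → χ (blockwise? (suc N) (v ++ w))))
      ≡⟨ ∑ᵇ-cong q (λ v → ∑ᵇ-cong (N * q) (χ-split v)) ⟩
    ∑ᵇ q (λ v → ∑ᵇ (N * q) (λ w → χ (P? (lookup v)) * χ (blockwise? N w)))
      ≡⟨ ∑ᵇ-cong q (λ v → *-distribˡ-∑ᵇ (N * q) (χ (P? (lookup v))) (λ w → χ (blockwise? N w))) ⟩
    ∑ᵇ q (λ v → χ (P? (lookup v)) * ∑ᵇ (N * q) (λ w → χ (blockwise? N w)))
      ≡⟨ *-distribʳ-∑ᵇ q (∑ᵇ (N * q) (λ w → χ (blockwise? N w))) (λ v → χ (P? (lookup v))) ⟩
    ∑ᵇ q (λ v → χ (P? (lookup v))) * ∑ᵇ (N * q) (λ w → χ (blockwise? N w))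
      ≡⟨ cong (∑ᵇ q (λ v → χ (P? (lookup v))) *_) (∑ᵇ-blockwise N) ⟩
    ∑ᵇ q (λ v → χ (P? (lookup v))) ^ suc N ∎
    where
    open ≡-Reasoning
    χ-split : ∀ v w → χ (blockwise? (suc N) (v ++ w)) ≡ χ (P? (lookup v)) * χ (blockwise? N w)
    χ-split v w = trans
      (χ-cong (blockwise? (suc N) (v ++ w)) (P? (lookup v) ×-dec blockwise? N w)
        (λ all → P-resp (lookup-++ˡ v w) (all zero) , λ i → P-resp (lookup-++ʳ v w ∘ combine i) (all (suc i)))
        (λ { (P₀ , Pₛ) zero    → P-resp (sym ∘ lookup-++ˡ v w) P₀
           ; (P₀ , Pₛ) (suc i) → P-resp (sym ∘ lookup-++ʳ v w ∘ combine i) (Pₛ i) }))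
      (χ-× (P? (lookup v)) (blockwise? N w))

-- The cyclic order of Fin (suc n)

nextᵛ : ∀ {n} {i : Fin (suc n)} → View i → Fin (suc n)
nextᵛ ‵fromℕ            = zero
nextᵛ (‵inj₁ {i = j} _) = suc j

next : ∀ {n} → Fin (suc n) → Fin (suc n)
next i = nextᵛ (view i)

prev : ∀ {n} → Fin (suc n) → Fin (suc n)
prev zero    = fromℕ _
prev (suc i) = inject₁ i

prev-next : ∀ {n} (i : Fin (suc n)) → prev (next i) ≡ i
prev-next i = prev-nextᵛ (view i)
  where
  prev-nextᵛ : ∀ {i} (v : View i) → prev (nextᵛ v) ≡ i
  prev-nextᵛ ‵fromℕ   = refl
  prev-nextᵛ (‵inj₁ _) = refl

next-prev : ∀ {n} (i : Fin (suc n)) → next (prev i) ≡ i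
next-prev {n} zero    rewrite view-fromℕ n   = refl
next-prev     (suc i) rewrite view-inject₁ i = refl

δ-next : ∀ {n} (i j : Fin (suc n)) → δ (next i) j ≡ δ i (prev j)
δ-next i j = χ-cong (next i ≟ j) (i ≟ prev j)
  (λ e → trans (sym (prev-next i)) (cong prev e)) (λ e → trans (cong next e) (next-prev j))

stepwise-constant : ∀ {n} {A : Set} (c : Fin (suc n) → A) → (∀ j → c (suc j) ≡ c (inject₁ j)) → ∀ i → c i ≡ c zero
stepwise-constant         c step zero    = refl
stepwise-constant {suc n} c step (suc j) = trans (step j) (stepwise-constant (c ∘ inject₁) (step ∘ inject₁) j)

at-most-one : ∀ {A : ℕ → Set} x → x ≤ 1 → A x → A 1 ⊎ A 0
at-most-one zero          _        a = inj₂ a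
at-most-one (suc zero)    _        a = inj₁ a
at-most-one (suc (suc _)) (s≤s ()) _

^-distrib-* : ∀ a b n → (a * b) ^ n ≡ a ^ n * b ^ n
^-distrib-* a b zero    = refl
^-distrib-* a b (suc n) = trans (cong (a * b *_) (^-distrib-* a b n)) (interchange a b (a ^ n) (b ^ n))
  where
  interchange : ∀ a b x y → a * b * (x * y) ≡ a * x * (b * y)
  interchange = solve-∀

combine-elim : ∀ {m n} {P : Fin (m * n) → Set} → (∀ i j → P (combine i j)) → ∀ k → P k
combine-elim {m} {n} {P} h k =
  subst P (combine-remQuot {m} n k) (h (proj₁ (remQuot {m} n k)) (proj₂ (remQuot {m} n k)))

-- Gadgets and necklaces

-- An edge whose right end is nothing leaves the gadget: in a necklace it ends at the
-- vertex entry of the next gadget.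
record Gadget (p q : ℕ) : Set where
  field
    leftEnd  : Fin q → Fin p
    rightEnd : Fin q → Maybe (Fin p)
    entry    : Fin p

module GadgetCovers {p q : ℕ} (Γ : Gadget p q) where

  open Gadget Γ public

  lands : Maybe (Fin p) → Fin p → ℕ
  lands (just r′) r = δ r′ r
  lands nothing   r = 0

  leaves : Maybe (Fin p) → ℕ
  leaves (just _) = 0
  leaves nothing  = 1

  leftDeg : (Fin q → Bool) → Fin p → ℕ
  leftDeg s l = ∑[ e < q ] (𝟙 (s e) * δ (leftEnd e) l)

  innerDeg : (Fin q → Bool) → Fin p → ℕ
  innerDeg s r = ∑[ e < q ] (𝟙 (s e) * lands (rightEnd e) r)

  exits : (Fin q → Bool) → ℕ
  exits s = ∑[ e < q ] (𝟙 (s e) * leaves (rightEnd e))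

  -- y counts the edges of the previous gadget that enter at entry.
  record Covers (y : ℕ) (s : Fin q → Bool) : Set where
    constructor covering
    field
      left-once  : ∀ l → leftDeg s l ≡ 1
      right-once : ∀ r → innerDeg s r + y * δ entry r ≡ 1
  open Covers public

  covers? : ∀ y s → Dec (Covers y s)
  covers? y s = map′ (λ (l , r) → covering l r) (λ c → left-once c , right-once c)
    (all? (λ l → leftDeg s l ℕ.≟ 1) ×-dec all? (λ r → innerDeg s r + y * δ entry r ℕ.≟ 1))

  covers-resp : ∀ y {s t} → (∀ e → s e ≡ t e) → Covers y s → Covers y t
  covers-resp y s≗t (covering left₁ right₁) = covering
    (λ l → trans (sum-cong-≗ (λ e → cong (λ b → 𝟙 b * δ (leftEnd e) l) (sym (s≗t e)))) (left₁ l))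
    (λ r → trans (cong (_+ y * δ entry r) (sum-cong-≗ (λ e → cong (λ b → 𝟙 b * lands (rightEnd e) r) (sym (s≗t e)))))
                 (right₁ r))

  coverings : ℕ → ℕ
  coverings y = ∑ᵇ q (λ v → χ (covers? y (lookup v)))

  ∑-leftDeg : ∀ s → ∑[ l < p ] leftDeg s l ≡ ∑[ e < q ] 𝟙 (s e)
  ∑-leftDeg s = trans (∑∑-factorˡ (𝟙 ∘ s) (λ e → δ (leftEnd e)))
                      (sum-cong-≗ (λ e → trans (cong (𝟙 (s e) *_) (∑-δ₁ (leftEnd e))) (*-identityʳ _)))

  lands+leaves : ∀ m → ∑[ r < p ] lands m r + leaves m ≡ 1
  lands+leaves (just r′) = trans (+-identityʳ _) (∑-δ₁ r′)
  lands+leaves nothing   = cong (_+ 1) (sum-replicate-zero p)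

  ∑-innerDeg : ∀ s → ∑[ r < p ] innerDeg s r + exits s ≡ ∑[ e < q ] 𝟙 (s e)
  ∑-innerDeg s = begin
    ∑[ r < p ] innerDeg s r + exits s
      ≡⟨ cong (_+ exits s) (∑∑-factorˡ (𝟙 ∘ s) (λ e → lands (rightEnd e))) ⟩
    ∑[ e < q ] (𝟙 (s e) * ∑[ r < p ] lands (rightEnd e) r) + exits s
      ≡⟨ ∑-distrib-+ (λ e → 𝟙 (s e) * ∑[ r < p ] lands (rightEnd e) r) _ ⟨
    ∑[ e < q ] (𝟙 (s e) * ∑[ r < p ] lands (rightEnd e) r + 𝟙 (s e) * leaves (rightEnd e))
      ≡⟨ sum-cong-≗ (λ e → trans (sym (*-distribˡ-+ (𝟙 (s e)) _ _))
                                  (trans (cong (𝟙 (s e) *_) (lands+leaves (rightEnd e))) (*-identityʳ _))) ⟩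
    ∑[ e < q ] 𝟙 (s e) ∎
    where open ≡-Reasoning

  -- Every selected edge has one left end and either one right end in the gadget or leaves it,
  -- so a covering passes on exactly as many edges as it receives.
  covers⇒exits : ∀ {y s} → Covers y s → exits s ≡ y
  covers⇒exits {y} {s} (covering left₁ right₁) = +-cancelˡ-≡ (∑[ r < p ] innerDeg s r) _ _ (begin
    ∑[ r < p ] innerDeg s r + exits s         ≡⟨ ∑-innerDeg s ⟩
    ∑[ e < q ] 𝟙 (s e)                        ≡⟨ ∑-leftDeg s ⟨
    ∑[ l < p ] leftDeg s l                    ≡⟨ sum-cong-≗ left₁ ⟩
    ∑[ r < p ] 1                              ≡⟨ sum-cong-≗ right₁ ⟨
    ∑[ r < p ] (innerDeg s r + y * δ entry r) ≡⟨ ∑-distrib-+ (innerDeg s) _ ⟩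
    ∑[ r < p ] innerDeg s r + ∑[ r < p ] (y * δ entry r)
      ≡⟨ cong (∑[ r < p ] innerDeg s r +_)
              (trans (sym (*-distribˡ-sum y (δ entry))) (trans (cong (y *_) (∑-δ₁ entry)) (*-identityʳ y))) ⟩
    ∑[ r < p ] innerDeg s r + y ∎)
    where open ≡-Reasoning

  -- col e is the right end of e once every exit edge is reattached at entry of its own gadget.
  module Closing (col : Fin q → Fin p) (col-inner : ∀ e {r} → rightEnd e ≡ just r → col e ≡ r)
                 (col-exit : ∀ e → rightEnd e ≡ nothing → col e ≡ entry) where

    closedDeg : (Fin q → Bool) → Fin p → ℕ
    closedDeg s r = ∑[ e < q ] (𝟙 (s e) * δ (col e) r)

    lands+leaves≡δ : ∀ e r → lands (rightEnd e) r + leaves (rightEnd e) * δ entry r ≡ δ (col e) r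
    lands+leaves≡δ e r with rightEnd e in eq
    ... | just r′ = trans (+-identityʳ _) (cong (λ c → δ c r) (sym (col-inner e eq)))
    ... | nothing = trans (+-identityʳ _) (cong (λ c → δ c r) (sym (col-exit e eq)))

    innerDeg+exits : ∀ s r → innerDeg s r + exits s * δ entry r ≡ closedDeg s r
    innerDeg+exits s r = begin
      innerDeg s r + exits s * δ entry r
        ≡⟨ cong (innerDeg s r +_) (*-distribʳ-sum (δ entry r) (λ e → 𝟙 (s e) * leaves (rightEnd e))) ⟩
      innerDeg s r + ∑[ e < q ] (𝟙 (s e) * leaves (rightEnd e) * δ entry r)
        ≡⟨ ∑-distrib-+ (λ e → 𝟙 (s e) * lands (rightEnd e) r) (λ e → 𝟙 (s e) * leaves (rightEnd e) * δ entry r) ⟨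
      ∑[ e < q ] (𝟙 (s e) * lands (rightEnd e) r + 𝟙 (s e) * leaves (rightEnd e) * δ entry r)
        ≡⟨ sum-cong-≗ (λ e → trans (factor (𝟙 (s e)) _ _ _) (cong (𝟙 (s e) *_) (lands+leaves≡δ e r))) ⟩
      closedDeg s r ∎
      where
      open ≡-Reasoning
      factor : ∀ a x y z → a * x + a * y * z ≡ a * (x + y * z)
      factor = solve-∀

    covers⇒closed : ∀ {y s} → Covers y s → ∀ r → closedDeg s r ≡ 1
    covers⇒closed {s = s} c r = trans (sym (innerDeg+exits s r))
      (trans (cong (λ x → innerDeg s r + x * δ entry r) (covers⇒exits c)) (right-once c r))

    closed⇒covers : ∀ {y s} → (∀ l → leftDeg s l ≡ 1) → (∀ r → closedDeg s r ≡ 1) → exits s ≡ y → Covers y s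
    closed⇒covers {s = s} left₁ closed₁ exits≡y = covering left₁
      (λ r → trans (cong (λ x → innerDeg s r + x * δ entry r) (sym exits≡y)) (trans (innerDeg+exits s r) (closed₁ r)))

module Necklace {p q : ℕ} (Γ : Gadget p q) (n : ℕ) where

  open GadgetCovers Γ public

  N : ℕ
  N = suc n

  target : Fin N → Maybe (Fin p) → Fin (N * p)
  target i (just r) = combine i r
  target i nothing  = combine (next i) entry

  necklace : BipGraph (N * p) (N * p) (N * q)
  necklace = record
    { left  = λ ι → let (i , e) = remQuot {N} q ι in combine i (leftEnd e)
    ; right = λ ι → let (i , e) = remQuot {N} q ι in target i (rightEnd e)
    }

  left-combine : ∀ i e → left necklace (combine i e) ≡ combine i (leftEnd e)
  left-combine i e = cong (λ (i , e) → combine i (leftEnd e)) (remQuot-combine {N} {q} i e)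

  right-combine : ∀ i e → right necklace (combine i e) ≡ target i (rightEnd e)
  right-combine i e = cong (λ (i , e) → target i (rightEnd e)) (remQuot-combine {N} {q} i e)

  _at_ : (Fin (N * q) → Bool) → Fin N → Fin q → Bool
  (σ at i) e = σ (combine i e)

  degree-by-gadget : ∀ {a} (σ : Fin (N * q) → Bool) (end : Fin (N * q) → Fin a) (v : Fin a) →
    countTrue (N * q) (λ ι → σ ι ∧ ⌊ end ι ≟ v ⌋)
      ≡ ∑[ i < N ] ∑[ e < q ] (𝟙 ((σ at i) e) * δ (end (combine i e)) v)
  degree-by-gadget σ end v = trans (degree≡∑ σ end v) (∑-combine N q _)

  leftCount : ∀ σ i₀ l → countTrue (N * q) (λ ι → σ ι ∧ ⌊ left necklace ι ≟ combine i₀ l ⌋)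
                         ≡ leftDeg (σ at i₀) l
  leftCount σ i₀ l = begin
    countTrue (N * q) (λ ι → σ ι ∧ ⌊ left necklace ι ≟ combine i₀ l ⌋)
      ≡⟨ degree-by-gadget σ (left necklace) (combine i₀ l) ⟩
    ∑[ i < N ] ∑[ e < q ] (𝟙 ((σ at i) e) * δ (left necklace (combine i e)) (combine i₀ l))
      ≡⟨ sum-cong-≗ (λ i → sum-cong-≗ (λ e → term i e)) ⟩
    ∑[ i < N ] ∑[ e < q ] (δ i i₀ * (𝟙 ((σ at i) e) * δ (leftEnd e) l))
      ≡⟨ sum-cong-≗ (λ i → *-distribˡ-sum (δ i i₀) (λ e → 𝟙 ((σ at i) e) * δ (leftEnd e) l)) ⟨
    ∑[ i < N ] (δ i i₀ * leftDeg (σ at i) l)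
      ≡⟨ ∑-δ i₀ (λ i → leftDeg (σ at i) l) ⟩
    leftDeg (σ at i₀) l ∎
    where
    open ≡-Reasoning
    term : ∀ i e → 𝟙 ((σ at i) e) * δ (left necklace (combine i e)) (combine i₀ l)
                 ≡ δ i i₀ * (𝟙 ((σ at i) e) * δ (leftEnd e) l)
    term i e rewrite left-combine i e | δ-combine i i₀ (leftEnd e) l =
      x*[y*z]≡y*[x*z] (𝟙 ((σ at i) e)) (δ i i₀) (δ (leftEnd e) l)
      where
      x*[y*z]≡y*[x*z] : ∀ x y z → x * (y * z) ≡ y * (x * z)
      x*[y*z]≡y*[x*z] = solve-∀

  target-δ : ∀ i m i₀ r → δ (target i m) (combine i₀ r) ≡ δ i i₀ * lands m r + δ (next i) i₀ * (leaves m * δ entry r)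
  target-δ i (just r′) i₀ r = trans (δ-combine i i₀ r′ r)
    (sym (trans (cong (δ i i₀ * δ r′ r +_) (*-zeroʳ (δ (next i) i₀))) (+-identityʳ _)))
  target-δ i nothing   i₀ r = trans (δ-combine (next i) i₀ entry r)
    (sym (trans (cong (_+ δ (next i) i₀ * (1 * δ entry r)) (*-zeroʳ (δ i i₀)))
                (cong (δ (next i) i₀ *_) (+-identityʳ (δ entry r)))))

  rightCount : ∀ σ i₀ r → countTrue (N * q) (λ ι → σ ι ∧ ⌊ right necklace ι ≟ combine i₀ r ⌋)
                          ≡ innerDeg (σ at i₀) r + exits (σ at prev i₀) * δ entry r
  rightCount σ i₀ r = begin
    countTrue (N * q) (λ ι → σ ι ∧ ⌊ right necklace ι ≟ combine i₀ r ⌋)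
      ≡⟨ degree-by-gadget σ (right necklace) (combine i₀ r) ⟩
    ∑[ i < N ] ∑[ e < q ] (𝟙 ((σ at i) e) * δ (right necklace (combine i e)) (combine i₀ r))
      ≡⟨ sum-cong-≗ (λ i → sum-cong-≗ (λ e → term i e)) ⟩
    ∑[ i < N ] ∑[ e < q ] (δ i i₀ * inner i e + δ (next i) i₀ * (exiting i e * δ entry r))
      ≡⟨ sum-cong-≗ (λ i → ∑-distrib-+ (λ e → δ i i₀ * inner i e)
                                        (λ e → δ (next i) i₀ * (exiting i e * δ entry r))) ⟩
    ∑[ i < N ] (∑[ e < q ] (δ i i₀ * inner i e) + ∑[ e < q ] (δ (next i) i₀ * (exiting i e * δ entry r)))
      ≡⟨ sum-cong-≗ (λ i → cong₂ _+_ (sym (*-distribˡ-sum (δ i i₀) (inner i)))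
                                      (trans (sym (*-distribˡ-sum (δ (next i) i₀) (λ e → exiting i e * δ entry r)))
                                             (cong (δ (next i) i₀ *_) (sym (*-distribʳ-sum (δ entry r) (exiting i)))))) ⟩
    ∑[ i < N ] (δ i i₀ * innerDeg (σ at i) r + δ (next i) i₀ * (exits (σ at i) * δ entry r))
      ≡⟨ ∑-distrib-+ (λ i → δ i i₀ * innerDeg (σ at i) r) (λ i → δ (next i) i₀ * (exits (σ at i) * δ entry r)) ⟩
    ∑[ i < N ] (δ i i₀ * innerDeg (σ at i) r) + ∑[ i < N ] (δ (next i) i₀ * (exits (σ at i) * δ entry r))
      ≡⟨ cong₂ _+_ (∑-δ i₀ (λ i → innerDeg (σ at i) r))
                   (trans (sum-cong-≗ (λ i → cong (_* (exits (σ at i) * δ entry r)) (δ-next i i₀)))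
                          (∑-δ (prev i₀) (λ i → exits (σ at i) * δ entry r))) ⟩
    innerDeg (σ at i₀) r + exits (σ at prev i₀) * δ entry r ∎
    where
    open ≡-Reasoning
    inner exiting : Fin N → Fin q → ℕ
    inner   i e = 𝟙 ((σ at i) e) * lands (rightEnd e) r
    exiting i e = 𝟙 ((σ at i) e) * leaves (rightEnd e)
    term : ∀ i e → 𝟙 ((σ at i) e) * δ (right necklace (combine i e)) (combine i₀ r)
                 ≡ δ i i₀ * inner i e + δ (next i) i₀ * (exiting i e * δ entry r)
    term i e rewrite right-combine i e | target-δ i (rightEnd e) i₀ r =
      distribute (𝟙 ((σ at i) e)) (δ i i₀) (lands (rightEnd e) r) (δ (next i) i₀) (leaves (rightEnd e)) (δ entry r)
      where
      distribute : ∀ a x y z w t → a * (x * y + z * (w * t)) ≡ x * (a * y) + z * ((a * w) * t)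
      distribute = solve-∀

  Uniform : ℕ → Vec Bool (N * q) → Set
  Uniform x = blockwise (covers? x) (covers-resp x) N

  uniform? : ∀ x S → Dec (Uniform x S)
  uniform? x = blockwise? (covers? x) (covers-resp x) N

  uniform⇒perfect : ∀ x S → Uniform x S → IsPerfectMatching necklace S
  uniform⇒perfect _ S cov =
    combine-elim (λ i l → trans (leftCount σ i l) (left-once (cov i) l)) ,
    combine-elim (λ i r → trans (rightCount σ i r)
      (trans (cong (λ y → innerDeg (σ at i) r + y * δ entry r) (covers⇒exits (cov (prev i)))) (right-once (cov i) r)))
    where σ = lookup S

  perfect⇒uniform : ∀ S → IsPerfectMatching necklace S →
    exits (lookup S at zero) ≤ 1 × Uniform (exits (lookup S at zero)) S
  perfect⇒uniform S (left₁ , right₁) = exits≤1 , covered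
    where
    σ = lookup S
    x = exits (σ at zero)
    local : ∀ i → Covers (exits (σ at prev i)) (σ at i)
    local i = covering (λ l → trans (sym (leftCount σ i l)) (left₁ (combine i l)))
                       (λ r → trans (sym (rightCount σ i r)) (right₁ (combine i r)))
    constant : ∀ i → exits (σ at i) ≡ x
    constant = stepwise-constant (λ i → exits (σ at i)) (λ j → covers⇒exits (local (suc j)))
    covered : ∀ i → Covers x (σ at i)
    covered i = subst (λ y → Covers y (σ at i)) (constant (prev i)) (local i)
    exits≤1 : x ≤ 1
    exits≤1 = begin
      x                                            ≡⟨ trans (cong (x *_) (δ-refl entry)) (*-identityʳ x) ⟨
      x * δ entry entry                            ≤⟨ m≤n+m _ (innerDeg (σ at zero) entry) ⟩
      innerDeg (σ at zero) entry + x * δ entry entry ≡⟨ right-once (covered zero) entry ⟩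
      1                                            ∎
      where open ≤-Reasoning

  χ-perfect : ∀ S → χ (isPerfectMatching? necklace S) ≡ χ (uniform? 1 S) + χ (uniform? 0 S)
  χ-perfect S = χ-⊎ (uniform? 1 S) (uniform? 0 S) (isPerfectMatching? necklace S)
    (λ pm → let (x≤1 , cov) = perfect⇒uniform S pm in at-most-one {λ x → Uniform x S} _ x≤1 cov)
    [ uniform⇒perfect 1 S , uniform⇒perfect 0 S ]
    (λ cov₁ cov₀ → 1+n≢0 (trans (sym (covers⇒exits (cov₁ zero))) (covers⇒exits (cov₀ zero))))

  numPM-necklace : numPM necklace ≡ coverings 1 ^ N + coverings 0 ^ N
  numPM-necklace = begin
    numPM necklace
      ≡⟨ count≡∑ᵇ (N * q) (isPerfectMatching? necklace) ⟩
    ∑ᵇ (N * q) (λ S → χ (isPerfectMatching? necklace S))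
      ≡⟨ ∑ᵇ-cong (N * q) χ-perfect ⟩
    ∑ᵇ (N * q) (λ S → χ (uniform? 1 S) + χ (uniform? 0 S))
      ≡⟨ ∑ᵇ-distrib-+ (N * q) (λ S → χ (uniform? 1 S)) (λ S → χ (uniform? 0 S)) ⟩
    ∑ᵇ (N * q) (λ S → χ (uniform? 1 S)) + ∑ᵇ (N * q) (λ S → χ (uniform? 0 S))
      ≡⟨ cong₂ _+_ (∑ᵇ-blockwise (covers? 1) (covers-resp 1) N) (∑ᵇ-blockwise (covers? 0) (covers-resp 0) N) ⟩
    coverings 1 ^ N + coverings 0 ^ N ∎
    where open ≡-Reasoning

  necklace-regular : ∀ d → (∀ l → leftDeg (λ _ → true) l ≡ d) →
                     (∀ r → innerDeg (λ _ → true) r + exits (λ _ → true) * δ entry r ≡ d) → Regular necklace d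
  necklace-regular d left-d right-d =
    combine-elim (λ i l → trans (leftCount (λ _ → true) i l) (left-d l)) ,
    combine-elim (λ i r → trans (rightCount (λ _ → true) i r) (right-d r))

  module SingleExit (e₀ : Fin q) (exit : rightEnd e₀ ≡ nothing)
                    (exit-unique : ∀ e → rightEnd e ≡ nothing → e ≡ e₀) where

    leaves≡δ : ∀ e → leaves (rightEnd e) ≡ δ e e₀
    leaves≡δ e with rightEnd e in eq
    ... | just _  = sym (δ-≢ (λ e≡e₀ → just≢nothing (trans (sym eq) (trans (cong rightEnd e≡e₀) exit))))
      where
      just≢nothing : ∀ {r : Fin p} → just r ≢ nothing
      just≢nothing ()
    ... | nothing = trans (sym (δ-refl e)) (cong (δ e) (exit-unique e eq))

    exits≡𝟙 : ∀ s → exits s ≡ 𝟙 (s e₀)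
    exits≡𝟙 s = trans (sum-cong-≗ (λ e → trans (cong (𝟙 (s e) *_) (leaves≡δ e)) (*-comm (𝟙 (s e)) (δ e e₀))))
                      (∑-δ e₀ (𝟙 ∘ s))

    exit₀ : Fin (N * q)
    exit₀ = combine {N} zero e₀

    numPMwith-exit₀ : numPMwith necklace exit₀ ≡ coverings 1 ^ N
    numPMwith-exit₀ = begin
      numPMwith necklace exit₀
        ≡⟨ count≡∑ᵇ (N * q) perfect∋exit₀? ⟩
      ∑ᵇ (N * q) (λ S → χ (perfect∋exit₀? S))
        ≡⟨ ∑ᵇ-cong (N * q) (λ S → χ-cong (perfect∋exit₀? S) (uniform? 1 S) (to S) (from S)) ⟩
      ∑ᵇ (N * q) (λ S → χ (uniform? 1 S))
        ≡⟨ ∑ᵇ-blockwise (covers? 1) (covers-resp 1) N ⟩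
      coverings 1 ^ N ∎
      where
      open ≡-Reasoning
      perfect∋exit₀? : ∀ S → Dec (IsPerfectMatching necklace S × lookup S exit₀ ≡ true)
      perfect∋exit₀? S = isPerfectMatching? necklace S ×-dec (lookup S exit₀ Bool.≟ true)
      to : ∀ S → IsPerfectMatching necklace S × lookup S exit₀ ≡ true → Uniform 1 S
      to S (pm , used) = subst (λ x → Uniform x S)
                               (trans (exits≡𝟙 (lookup S at zero)) (cong 𝟙 used)) (proj₂ (perfect⇒uniform S pm))
      from : ∀ S → Uniform 1 S → IsPerfectMatching necklace S × lookup S exit₀ ≡ true
      from S cov = uniform⇒perfect 1 S cov ,
                   𝟙≡1⇒≡true (trans (sym (exits≡𝟙 (lookup S at zero))) (covers⇒exits (cov zero)))

    necklace-probability : ∀ k → coverings 0 ≡ k * coverings 1 → 0 < coverings 1 →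
                           ProbEq1/ necklace exit₀ (k ^ N + 1)
    necklace-probability k c₀≡k*c₁ c₁>0 = 0<numPM , trans (cong (_* (k ^ N + 1)) numPMwith-exit₀) (sym numPM≡)
      where
      c₁ = coverings 1
      numPM≡ : numPM necklace ≡ c₁ ^ N * (k ^ N + 1)
      numPM≡ = begin
        numPM necklace              ≡⟨ numPM-necklace ⟩
        c₁ ^ N + coverings 0 ^ N    ≡⟨ cong (λ c₀ → c₁ ^ N + c₀ ^ N) c₀≡k*c₁ ⟩
        c₁ ^ N + (k * c₁) ^ N       ≡⟨ cong (c₁ ^ N +_) (^-distrib-* k c₁ N) ⟩
        c₁ ^ N + k ^ N * c₁ ^ N     ≡⟨ factor (c₁ ^ N) (k ^ N) ⟩
        c₁ ^ N * (k ^ N + 1)        ∎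
        where
        open ≡-Reasoning
        factor : ∀ c x → c + x * c ≡ c * (x + 1)
        factor = solve-∀
      0<numPM : 0 < numPM necklace
      0<numPM = subst (0 <_) (sym numPM≡) (*-mono-≤ (m^n>0 c₁ {{>-nonZero c₁>0}} N) (m≤n+m 1 (k ^ N)))

    module _ (internal-simple : ∀ e e′ → leftEnd e ≡ leftEnd e′ → rightEnd e ≡ rightEnd e′ → e ≡ e′)
             (no-parallel-exit : ∀ e → leftEnd e ≡ leftEnd e₀ → rightEnd e ≢ just entry) where

      same-ends : ∀ i e i′ e′ → combine i (leftEnd e) ≡ combine i′ (leftEnd e′) →
                  target i (rightEnd e) ≡ target i′ (rightEnd e′) → combine {N} i e ≡ combine i′ e′
      same-ends i e i′ e′ hl hr with combine-injective i (leftEnd e) i′ (leftEnd e′) hl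
      ... | refl , sameLeft with rightEnd e in eq | rightEnd e′ in eq′
      ... | just r  | just r′ = cong (combine i) (internal-simple e e′ sameLeft
                                  (trans eq (trans (cong just (proj₂ (combine-injective i r i r′ hr))) (sym eq′))))
      ... | nothing | nothing = cong (combine i) (trans (exit-unique e eq) (sym (exit-unique e′ eq′)))
      ... | just r  | nothing = ⊥-elim (no-parallel-exit e (trans sameLeft (cong leftEnd (exit-unique e′ eq′)))
                                  (trans eq (cong just (proj₂ (combine-injective i r (next i) entry hr)))))
      ... | nothing | just r′ = ⊥-elim (no-parallel-exit e′ (trans (sym sameLeft) (cong leftEnd (exit-unique e eq)))
                                  (trans eq′ (cong just (proj₂ (combine-injective i r′ (next i) entry (sym hr))))))

      necklace-simple : Simple necklace
      necklace-simple = combine-elim λ i e → combine-elim λ i′ e′ sameLeft sameRight →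
        same-ends i e i′ e′ (trans (sym (left-combine i e)) (trans sameLeft (left-combine i′ e′)))
                            (trans (sym (right-combine i e)) (trans sameRight (right-combine i′ e′)))

-- 0/1 matrices with prescribed margins

-- A matrix with a rows and d columns is stored row by row in a Vec Bool (a * d).
module Margins (d : ℕ) where

  rowSum : ∀ a → (Fin (a * d) → Bool) → Fin a → ℕ
  rowSum a s l = ∑[ c < d ] 𝟙 (s (combine l c))

  colSum : ∀ a → (Fin (a * d) → Bool) → Fin d → ℕ
  colSum a s c = ∑[ l < a ] 𝟙 (s (combine {a} l c))

  record HasMargins (a : ℕ) (t : Fin d → ℕ) (M : Vec Bool (a * d)) : Set where
    constructor margins
    field
      rows-one : ∀ l → rowSum a (lookup M) l ≡ 1
      cols     : ∀ c → colSum a (lookup M) c ≡ t c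
  open HasMargins public

  hasMargins? : ∀ a t M → Dec (HasMargins a t M)
  hasMargins? a t M = map′ (λ (r , c) → margins r c) (λ m → rows-one m , cols m)
    (all? (λ l → rowSum a (lookup M) l ℕ.≟ 1) ×-dec all? (λ c → colSum a (lookup M) c ℕ.≟ t c))

  #margins : ∀ a → (Fin d → ℕ) → ℕ
  #margins a t = ∑ᵇ (a * d) (λ M → χ (hasMargins? a t M))

  module _ {a : ℕ} (v : Vec Bool d) (M : Vec Bool (a * d)) where

    rowSum-head : rowSum (suc a) (lookup (v ++ M)) zero ≡ weight v
    rowSum-head = sum-cong-≗ (λ c → cong 𝟙 (lookup-++ˡ v M c))

    rowSum-tail : ∀ l → rowSum (suc a) (lookup (v ++ M)) (suc l) ≡ rowSum a (lookup M) l
    rowSum-tail l = sum-cong-≗ (λ c → cong 𝟙 (lookup-++ʳ v M (combine l c)))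

    colSum-++ : ∀ c → colSum (suc a) (lookup (v ++ M)) c ≡ 𝟙 (lookup v c) + colSum a (lookup M) c
    colSum-++ c = cong₂ _+_ (cong 𝟙 (lookup-++ˡ v M c)) (sum-cong-≗ (λ l → cong 𝟙 (lookup-++ʳ v M (combine {a} l c))))

  ∑ᵇ-first-row : ∀ a (F : Vec Bool (suc a * d) → ℕ) → (∀ M → rowSum (suc a) (lookup M) zero ≢ 1 → F M ≡ 0) →
                 ∑ᵇ (suc a * d) F ≡ ∑[ j < d ] ∑ᵇ (a * d) (λ M → F (unit j ++ M))
  ∑ᵇ-first-row a F F≡0 = trans (∑ᵇ-++ d (a * d) F)
    (∑ᵇ-weight1 d _ (λ v w≢1 → ∑ᵇ-zero (a * d) (λ M → F≡0 (v ++ M) (w≢1 ∘ trans (sym (rowSum-head {a} v M))))))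

  weight-unit : (j : Fin d) → weight (unit j) ≡ 1
  weight-unit j = trans (sum-cong-≗ (λ c → sym (*-identityʳ (𝟙 (lookup (unit j) c))))) (∑-unit j (λ _ → 1))

  module _ {t : Fin d → ℕ} (j : Fin d) where

    δ≤ : 1 ≤ t j → ∀ c → δ c j ≤ t c
    δ≤ 1≤tj c with c ≟ j
    ... | yes refl = 1≤tj
    ... | no  _    = z≤n

    unit-row⇒ : ∀ {a} M → HasMargins (suc a) t (unit j ++ M) → 1 ≤ t j × HasMargins a (λ c → t c ∸ δ c j) M
    unit-row⇒ {a} M (margins rows cols) =
      subst (1 ≤_) (trans (cong (_+ colSum a (lookup M) j) (sym (δ-refl j))) (col j)) (s≤s z≤n) ,
      margins (λ l → trans (sym (rowSum-tail {a} (unit j) M l)) (rows (suc l)))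
              (λ c → trans (sym (m+n∸m≡n (δ c j) _)) (cong (_∸ δ c j) (col c)))
      where
      col : ∀ c → δ c j + colSum a (lookup M) c ≡ t c
      col c = trans (cong (_+ colSum a (lookup M) c) (sym (𝟙-lookup-unit j c)))
                    (trans (sym (colSum-++ {a} (unit j) M c)) (cols c))

    unit-row⇐ : ∀ {a} M → 1 ≤ t j × HasMargins a (λ c → t c ∸ δ c j) M → HasMargins (suc a) t (unit j ++ M)
    unit-row⇐ {a} M (1≤tj , margins rows cols) = margins
      (λ { zero    → trans (rowSum-head {a} (unit j) M) (weight-unit j)
         ; (suc l) → trans (rowSum-tail {a} (unit j) M l) (rows l) })
      (λ c → trans (colSum-++ {a} (unit j) M c)
                   (trans (cong₂ _+_ (𝟙-lookup-unit j c) (cols c)) (m+[n∸m]≡n (δ≤ 1≤tj c))))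

    ∑-remove : 1 ≤ t j → ∀ {b} → sum t ≡ suc b → ∑[ c < d ] (t c ∸ δ c j) ≡ b
    ∑-remove 1≤tj {b} ∑t≡1+b = suc-injective (begin
      suc (∑[ c < d ] (t c ∸ δ c j))                      ≡⟨ +-comm 1 _ ⟩
      ∑[ c < d ] (t c ∸ δ c j) + 1                         ≡⟨ cong (∑[ c < d ] (t c ∸ δ c j) +_) (∑-δ j (λ _ → 1)) ⟨
      ∑[ c < d ] (t c ∸ δ c j) + ∑[ c < d ] (δ c j * 1)    ≡⟨ ∑-distrib-+ (λ c → t c ∸ δ c j) (λ c → δ c j * 1) ⟨
      ∑[ c < d ] (t c ∸ δ c j + δ c j * 1)                 ≡⟨ sum-cong-≗ (λ c → trans (cong (t c ∸ δ c j +_) (*-identityʳ (δ c j)))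
                                                                                      (m∸n+n≡m (δ≤ 1≤tj c))) ⟩
      sum t                                                ≡⟨ ∑t≡1+b ⟩
      suc b                                                ∎)
      where open ≡-Reasoning

  -- The first row of such a matrix is a unit vector e_j with t j = 1, and the remaining rows
  -- have column sums t − e_j.
  mutual
    margins-count : ∀ a (t : Fin d → ℕ) → (∀ c → t c ≤ 1) → sum t ≡ a → #margins a t ≡ a !
    margins-count zero    t _   ∑t≡0   = χ-yes (hasMargins? 0 t []) (margins (λ ()) (λ c → sym (∑≡0⇒≡0 t ∑t≡0 c)))
    margins-count (suc a) t t≤1 ∑t≡1+a = begin
      #margins (suc a) t
        ≡⟨ ∑ᵇ-first-row a (λ M → χ (hasMargins? (suc a) t M))
                          (λ M r≢1 → χ-no (hasMargins? (suc a) t M) (λ m → r≢1 (rows-one m zero))) ⟩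
      ∑[ j < d ] ∑ᵇ (a * d) (λ M → χ (hasMargins? (suc a) t (unit j ++ M)))
        ≡⟨ sum-cong-≗ (λ j → unit-row-count a t j t≤1 ∑t≡1+a) ⟩
      ∑[ j < d ] (t j * a !)
        ≡⟨ *-distribʳ-sum (a !) t ⟨
      sum t * a !
        ≡⟨ cong (_* a !) ∑t≡1+a ⟩
      suc a ! ∎
      where open ≡-Reasoning

    unit-row-count : ∀ a (t : Fin d → ℕ) j → (∀ c → t c ≤ 1) → sum t ≡ suc a →
                     ∑ᵇ (a * d) (λ M → χ (hasMargins? (suc a) t (unit j ++ M))) ≡ t j * a !
    unit-row-count a t j t≤1 ∑t≡1+a = begin
      ∑ᵇ (a * d) (λ M → χ (hasMargins? (suc a) t (unit j ++ M)))
        ≡⟨ ∑ᵇ-cong (a * d) (λ M → trans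
             (χ-cong (hasMargins? (suc a) t (unit j ++ M)) (1 ≤? t j ×-dec hasMargins? a t′ M) (unit-row⇒ j M) (unit-row⇐ j M))
             (χ-× (1 ≤? t j) (hasMargins? a t′ M))) ⟩
      ∑ᵇ (a * d) (λ M → χ (1 ≤? t j) * χ (hasMargins? a t′ M))
        ≡⟨ *-distribˡ-∑ᵇ (a * d) (χ (1 ≤? t j)) (λ M → χ (hasMargins? a t′ M)) ⟩
      χ (1 ≤? t j) * #margins a t′
        ≡⟨ choose (1 ≤? t j) ⟩
      t j * a ! ∎
      where
      open ≡-Reasoning
      t′ : Fin d → ℕ
      t′ c = t c ∸ δ c j
      choose : (1≤?tj : Dec (1 ≤ t j)) → χ 1≤?tj * #margins a t′ ≡ t j * a !
      choose (yes 1≤tj) = begin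
        1 * #margins a t′ ≡⟨ *-identityˡ _ ⟩
        #margins a t′     ≡⟨ margins-count a t′ (λ c → ≤-trans (m∸n≤m (t c) (δ c j)) (t≤1 c)) (∑-remove j 1≤tj ∑t≡1+a) ⟩
        a !               ≡⟨ *-identityˡ (a !) ⟨
        1 * a !           ≡⟨ cong (_* a !) (≤-antisym 1≤tj (t≤1 j)) ⟩
        t j * a !         ∎
      choose (no 1≰tj)  = cong (_* a !) (sym (n<1⇒n≡0 (≰⇒> 1≰tj)))

-- The two necklaces

#[δ₀≡1] : ∀ k → ∑[ j < suc k ] χ (δ zero j ℕ.≟ 1) ≡ 1
#[δ₀≡1] k = cong suc (sum-replicate-zero k)

#[δ₀≡0] : ∀ k → ∑[ j < suc k ] χ (δ zero j ℕ.≟ 0) ≡ k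
#[δ₀≡0] k = trans (∑-const k 1) (*-identityʳ k)

parallelGadget : ∀ k → Gadget 1 (suc k)
parallelGadget k = record
  { leftEnd  = λ _ → zero
  ; rightEnd = λ { zero → nothing ; (suc _) → just zero }
  ; entry    = zero
  }

module ParallelNecklace (k n : ℕ) where

  open Necklace (parallelGadget k) n public

  exit-unique : ∀ e → rightEnd e ≡ nothing → e ≡ zero
  exit-unique zero _ = refl

  open SingleExit zero refl exit-unique public

  coverings≡ : ∀ y → coverings y ≡ ∑[ j < suc k ] χ (δ zero j ℕ.≟ y)
  coverings≡ y = trans (∑ᵇ-weight1 (suc k) (λ v → χ (covers? y (lookup v))) not-unit)
                       (sum-cong-≗ (λ j → χ-cong (covers? y (lookup (unit j))) (δ zero j ℕ.≟ y) (to j) (from j)))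
    where
    not-unit : ∀ v → weight v ≢ 1 → χ (covers? y (lookup v)) ≡ 0
    not-unit v w≢1 = χ-no (covers? y (lookup v))
      (λ c → w≢1 (trans (sum-cong-≗ (λ e → sym (*-identityʳ (𝟙 (lookup v e))))) (left-once c zero)))
    to : ∀ j → Covers y (lookup (unit j)) → δ zero j ≡ y
    to j c = trans (sym (𝟙-lookup-unit j zero)) (trans (sym (exits≡𝟙 (lookup (unit j)))) (covers⇒exits c))
    entry-once : ∀ j → lands (rightEnd j) zero + δ zero j * 1 ≡ 1
    entry-once zero    = refl
    entry-once (suc _) = refl
    from : ∀ j → δ zero j ≡ y → Covers y (lookup (unit j))
    from j refl = covering
      (λ { zero → ∑-unit j (λ _ → 1) })
      (λ { zero → trans (cong (_+ δ zero j * 1) (∑-unit j (λ e → lands (rightEnd e) zero))) (entry-once j) })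

  regular : Regular necklace (suc k)
  regular = necklace-regular (suc k)
    (λ { zero → trans (∑-const (suc k) 1) (*-identityʳ (suc k)) })
    (λ { zero → trans (cong₂ _+_ (trans (∑-const k 1) (*-identityʳ k))
                                 (trans (*-identityʳ _) (exits≡𝟙 (λ _ → true))))
                      (+-comm k 1) })

  probability : ProbEq1/ necklace exit₀ (k ^ N + 1)
  probability = necklace-probability k
    (begin
      coverings 0      ≡⟨ trans (coverings≡ 0) (#[δ₀≡0] k) ⟩
      k                ≡⟨ *-identityʳ k ⟨
      k * 1            ≡⟨ cong (k *_) c₁≡1 ⟨
      k * coverings 1  ∎)
    (subst (0 <_) (sym c₁≡1) (s≤s z≤n))
    where
    open ≡-Reasoning
    c₁≡1 : coverings 1 ≡ 1
    c₁≡1 = trans (coverings≡ 1) (#[δ₀≡1] k)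

module CompleteNecklace (k n : ℕ) where

  d : ℕ
  d = suc k

  row column : Fin (d * d) → Fin d
  row    ι = proj₁ (remQuot {d} d ι)
  column ι = proj₂ (remQuot {d} d ι)

  -- The complete bipartite graph K_{d,d}, with combine l c joining l and c, except that its
  -- edge zero = combine zero zero leaves the gadget.
  completeGadget : Gadget d (d * d)
  completeGadget = record
    { leftEnd  = row
    ; rightEnd = λ { zero → nothing ; (suc ι) → just (column (suc ι)) }
    ; entry    = zero
    }

  open Necklace completeGadget n public
  open Margins d

  exit-unique : ∀ e → rightEnd e ≡ nothing → e ≡ zero
  exit-unique zero _ = refl

  open SingleExit zero refl exit-unique public

  column-inner : ∀ e {r} → rightEnd e ≡ just r → column e ≡ r
  column-inner (suc ι) refl = refl

  column-exit : ∀ e → rightEnd e ≡ nothing → column e ≡ entry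
  column-exit zero _ = refl

  open Closing column column-inner column-exit

  combine-row-column : ∀ ι → combine (row ι) (column ι) ≡ ι
  combine-row-column = combine-remQuot {d} d

  leftDeg≡rowSum : ∀ s l → leftDeg s l ≡ rowSum d s l
  leftDeg≡rowSum s l = begin
    ∑[ ι < d * d ] (𝟙 (s ι) * δ (row ι) l)
      ≡⟨ ∑-combine d d (λ ι → 𝟙 (s ι) * δ (row ι) l) ⟩
    ∑[ l′ < d ] ∑[ c < d ] (𝟙 (s (combine l′ c)) * δ (row (combine l′ c)) l)
      ≡⟨ sum-cong-≗ (λ l′ → sum-cong-≗ (λ c → cong (λ x → 𝟙 (s (combine l′ c)) * δ x l)
                                                    (cong proj₁ (remQuot-combine l′ c)))) ⟩
    ∑[ l′ < d ] ∑[ c < d ] (𝟙 (s (combine l′ c)) * δ l′ l)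
      ≡⟨ sum-cong-≗ (λ l′ → trans (sym (*-distribʳ-sum (δ l′ l) (λ c → 𝟙 (s (combine l′ c)))))
                                   (*-comm (rowSum d s l′) (δ l′ l))) ⟩
    ∑[ l′ < d ] (δ l′ l * rowSum d s l′)
      ≡⟨ ∑-δ l (rowSum d s) ⟩
    rowSum d s l ∎
    where open ≡-Reasoning

  closedDeg≡colSum : ∀ s r → closedDeg s r ≡ colSum d s r
  closedDeg≡colSum s r = begin
    ∑[ ι < d * d ] (𝟙 (s ι) * δ (column ι) r)
      ≡⟨ ∑-combine d d (λ ι → 𝟙 (s ι) * δ (column ι) r) ⟩
    ∑[ l < d ] ∑[ c < d ] (𝟙 (s (combine l c)) * δ (column (combine l c)) r)
      ≡⟨ sum-cong-≗ (λ l → sum-cong-≗ (λ c → trans (cong (λ x → 𝟙 (s (combine l c)) * δ x r)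
                                                          (cong proj₂ (remQuot-combine l c)))
                                                    (*-comm (𝟙 (s (combine l c))) (δ c r)))) ⟩
    ∑[ l < d ] ∑[ c < d ] (δ c r * 𝟙 (s (combine l c)))
      ≡⟨ sum-cong-≗ (λ (l : Fin d) → ∑-δ r (λ c → 𝟙 (s (combine l c)))) ⟩
    colSum d s r ∎
    where open ≡-Reasoning

  one : Fin d → ℕ
  one _ = 1

  covers⇒margins : ∀ {y} v → Covers y (lookup v) → HasMargins d one v × 𝟙 (lookup v zero) ≡ y
  covers⇒margins v c =
    margins (λ l → trans (sym (leftDeg≡rowSum (lookup v) l)) (left-once c l))
            (λ r → trans (sym (closedDeg≡colSum (lookup v) r)) (covers⇒closed c r)) ,
    trans (sym (exits≡𝟙 (lookup v))) (covers⇒exits c)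

  margins⇒covers : ∀ {y} v → HasMargins d one v × 𝟙 (lookup v zero) ≡ y → Covers y (lookup v)
  margins⇒covers v (m , corner≡y) = closed⇒covers
    (λ l → trans (leftDeg≡rowSum (lookup v) l) (rows-one m l))
    (λ r → trans (closedDeg≡colSum (lookup v) r) (cols m r))
    (trans (exits≡𝟙 (lookup v)) corner≡y)

  coverings≡ : ∀ y → coverings y ≡ k ! * ∑[ j < d ] χ (δ zero j ℕ.≟ y)
  coverings≡ y = begin
    ∑ᵇ (d * d) (λ v → χ (covers? y (lookup v)))
      ≡⟨ ∑ᵇ-cong (d * d) (λ v → trans (χ-cong (covers? y (lookup v)) (margins? v) (covers⇒margins v) (margins⇒covers v))
                                      (χ-× (hasMargins? d one v) (𝟙 (lookup v zero) ℕ.≟ y))) ⟩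
    ∑ᵇ (d * d) (λ v → χ (hasMargins? d one v) * χ (𝟙 (lookup v zero) ℕ.≟ y))
      ≡⟨ ∑ᵇ-first-row k _ (λ M r≢1 → cong (_* χ (𝟙 (lookup M zero) ℕ.≟ y))
                                           (χ-no (hasMargins? d one M) (λ m → r≢1 (rows-one m zero)))) ⟩
    ∑[ j < d ] ∑ᵇ (k * d) (λ M → χ (hasMargins? d one (unit j ++ M)) * χ (𝟙 (lookup (unit j ++ M) zero) ℕ.≟ y))
      ≡⟨ sum-cong-≗ (λ j → ∑ᵇ-cong (k * d) (λ M → cong (λ b → χ (hasMargins? d one (unit j ++ M)) * χ (b ℕ.≟ y))
                                                         (trans (cong 𝟙 (lookup-++ˡ (unit j) M zero)) (𝟙-lookup-unit j zero)))) ⟩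
    ∑[ j < d ] ∑ᵇ (k * d) (λ M → χ (hasMargins? d one (unit j ++ M)) * χ (δ zero j ℕ.≟ y))
      ≡⟨ sum-cong-≗ (λ j → *-distribʳ-∑ᵇ (k * d) (χ (δ zero j ℕ.≟ y))
                                           (λ M → χ (hasMargins? d one (unit j ++ M)))) ⟩
    ∑[ j < d ] (∑ᵇ (k * d) (λ M → χ (hasMargins? d one (unit j ++ M))) * χ (δ zero j ℕ.≟ y))
      ≡⟨ sum-cong-≗ (λ j → cong (_* χ (δ zero j ℕ.≟ y))
                                (trans (unit-row-count k one j (λ _ → ≤-refl) (trans (∑-const d 1) (*-identityʳ d)))
                                       (*-identityˡ (k !)))) ⟩
    ∑[ j < d ] (k ! * χ (δ zero j ℕ.≟ y))
      ≡⟨ *-distribˡ-sum {d} (k !) (λ j → χ (δ zero j ℕ.≟ y)) ⟨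
    k ! * ∑[ j < d ] χ (δ zero j ℕ.≟ y) ∎
    where
    open ≡-Reasoning
    margins? : ∀ v → Dec (HasMargins d one v × 𝟙 (lookup v zero) ≡ y)
    margins? v = hasMargins? d one v ×-dec (𝟙 (lookup v zero) ℕ.≟ y)

  regular : Regular necklace d
  regular = necklace-regular d
    (λ l → trans (leftDeg≡rowSum (λ _ → true) l) (trans (∑-const d 1) (*-identityʳ d)))
    (λ r → trans (innerDeg+exits (λ _ → true) r)
                 (trans (closedDeg≡colSum (λ _ → true) r) (trans (∑-const d 1) (*-identityʳ d))))

  internal-simple : ∀ e e′ → row e ≡ row e′ → rightEnd e ≡ rightEnd e′ → e ≡ e′
  internal-simple zero    zero     _       _         = refl
  internal-simple (suc ι) (suc ι′) sameRow sameRight = begin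
    suc ι                                       ≡⟨ combine-row-column (suc ι) ⟨
    combine (row (suc ι)) (column (suc ι))       ≡⟨ cong₂ combine sameRow (just-injective sameRight) ⟩
    combine (row (suc ι′)) (column (suc ι′))     ≡⟨ combine-row-column (suc ι′) ⟩
    suc ι′                                      ∎
    where open ≡-Reasoning

  no-parallel-exit : ∀ e → row e ≡ row zero → rightEnd e ≢ just entry
  no-parallel-exit (suc ι) sameRow sameRight with
    trans (sym (combine-row-column (suc ι))) (cong₂ combine sameRow (just-injective sameRight))
  ... | ()

  simple : Simple necklace
  simple = necklace-simple internal-simple no-parallel-exit

  probability : ProbEq1/ necklace exit₀ (k ^ N + 1)
  probability = necklace-probability k
    (begin
      coverings 0          ≡⟨ trans (coverings≡ 0) (cong (k ! *_) (#[δ₀≡0] k)) ⟩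
      k ! * k              ≡⟨ *-comm (k !) k ⟩
      k * k !              ≡⟨ cong (k *_) c₁≡k! ⟨
      k * coverings 1      ∎)
    (subst (0 <_) (sym c₁≡k!) (1≤n! k))
    where
    open ≡-Reasoning
    c₁≡k! : coverings 1 ≡ k !
    c₁≡k! = trans (coverings≡ 1) (trans (cong (k ! *_) (#[δ₀≡1] k)) (*-identityʳ (k !)))

regular-multigraph : (d n : ℕ) → d ≥ 1 → n ≥ 1 →
  Σ (BipGraph n n (d * n)) λ G → Regular G d × ∃[ e ] ProbEq1/ G e ((d ∸ 1) ^ n + 1)
regular-multigraph (suc k) (suc n) _ _ =
  subst₂ (λ a m → Σ (BipGraph a a m) λ G → Regular G (suc k) × ∃[ e ] ProbEq1/ G e (k ^ suc n + 1))
         (*-identityʳ (suc n)) (*-comm (suc n) (suc k))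
         (necklace , regular , exit₀ , probability)
  where open ParallelNecklace k n

regular-simple-graph : (d n : ℕ) → d ≥ 1 → n ≥ 1 →
  Σ (BipGraph (d * n) (d * n) (d * (d * n))) λ G → Regular G d × Simple G × ∃[ e ] ProbEq1/ G e ((d ∸ 1) ^ n + 1)
regular-simple-graph (suc k) (suc n) _ _ =
  subst₂ (λ a m → Σ (BipGraph a a m) λ G → Regular G (suc k) × Simple G × ∃[ e ] ProbEq1/ G e (k ^ suc n + 1))
         (*-comm (suc n) (suc k)) (edges (suc n) (suc k))
         (necklace , regular , simple , exit₀ , probability)
  where
  open CompleteNecklace k n
  edges : ∀ n d → n * (d * d) ≡ d * (d * n)
  edges = solve-∀

theorem5p2 :
    ((d n : ℕ) → d ≥ 1 → n ≥ 1 →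
      Σ (BipGraph n n (d * n)) λ G → Regular G d ×
        ∃[ e ] ProbEq1/ G e ((d ∸ 1) ^ n + 1))
    ×
    ((d n : ℕ) → d ≥ 1 → n ≥ 1 →
      Σ (BipGraph (d * n) (d * n) (d * (d * n))) λ G → Regular G d × Simple G ×
        ∃[ e ] ProbEq1/ G e ((d ∸ 1) ^ n + 1))
theorem5p2 = regular-multigraph , regular-simple-graph
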